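{- Let $\pi,\pi'\in\mathcal{OP}(n,d,r)$ have the same underlying unordered set partition, so that there is $\sigma\in\mathfrak{S}_d$ with $\sigma(\pi)=\pi'$, where $\sigma(\pi)_i=\pi_{\sigma^{ -1}(i)}$. Then $[\pi]_r=\mathrm{sgn}(\sigma)^r\,[\pi']_r$.
   Context: An ordered set partition of $[n]$ with $d$ blocks is a sequence $\pi=(\pi_1\mid\cdots\mid\pi_d)$ of nonempty pairwise disjoint subsets of $[n]$ with union $[n]$; forgetting the order gives the underlying unordered set partition. $\mathcal{OP}(n,d,r)$ is the set of those with every block of size at least $r$. Let $M=(x_{ij})_{1\le i,j\le n}$ be an $n\times n$ matrix of distinct indeterminates; $M_I^J$ is the determinant of the submatrix with rows $I$ and columns $J$ (both increasing). For $\pi\in\mathcal{OP}(n,d,r)$, an $r$-jellyfish tableau for $\pi$ is an array $T$ with $n-(d-1)r$ rows and $d$ columns, cells empty or containing elements of $[n]$, such that all cells in rows $1,\dots,r$ are nonempty, each row $i>r$ has exactly one nonempty cell, and the nonempty entries of column $j$ are exactly $\pi_j$, increasing downward; $\mathcal{J}_r(\pi)$ is their set. $\mathrm{sgn}(T)=(-1)^{\mathrm{inv}(T)}$, $\mathrm{inv}(T)$ being the number of inversions of the row reading word (rows left to right, top to bottom, empty cells skipped). $\mathrm{J}(T)=\prod_jM^{\pi_j}_{R_j(T)}$ with $R_j(T)$ the set of rows in which column $j$ is nonempty, and $[\pi]_r=\sum_{T\in\mathcal{J}_r(\pi)}\mathrm{sgn}(T)\mathrm{J}(T)$. -}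

module Defs where

open import Level using (Level)
open import Data.Nat as ℕ using (ℕ; zero; suc; _∸_; _≤_)
open import Data.Nat.Properties using (m∸n≤m)
open import Data.Fin as Fin using (Fin; toℕ; inject≤)
open import Data.Fin.Properties using (_<?_)
open import Data.Fin.Permutation using (Permutation′; _⟨$⟩ʳ_)
open import Data.List as List using (List; []; _∷_; length; filter; concatMap; catMaybes; foldr)
open import Data.Bool.ListAction using (all)
open import Data.List.Properties using (≡-dec)
open import Data.Vec as Vec using (Vec; []; _∷_; lookup; toList)
open import Data.Maybe using (Maybe; just; nothing; is-just)
open import Data.Bool using (Bool; true; false; _∧_; if_then_else_)
import Data.Bool
open import Data.Product using (_×_; _,_)
open import Relation.Nullary.Decidable using (⌊_⌋)
open import Relation.Nullary using (yes; no)
open import Algebra.Bundles using (CommutativeRing)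

-- Ordered set partitions of [n] = Fin n with d blocks, encoded by the
-- block-assignment map  π : Fin n → Fin d  (x ∈ π_j  iff  π x ≡ j).

block : ∀ {n d} → (Fin n → Fin d) → Fin d → List (Fin n)
block {n} π j = filter (λ x → π x Fin.≟ j) (List.allFin n)

InOP : (n d r : ℕ) → (Fin n → Fin d) → Set
InOP n d r π = ∀ j → (1 ≤ length (block π j)) × (r ≤ length (block π j))

invWord : ∀ {n} → List (Fin n) → ℕ
invWord [] = 0
invWord (x ∷ xs) = length (filter (λ y → y <? x) xs) ℕ.+ invWord xs

invPerm : ∀ {d} → Permutation′ d → ℕ
invPerm {d} σ = invWord (List.map (σ ⟨$⟩ʳ_) (List.allFin d))

Tableau : ℕ → ℕ → ℕ → Set
Tableau n d m = Vec (Vec (Maybe (Fin n)) d) m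

jrows : ℕ → ℕ → ℕ → ℕ
jrows n d r = n ∸ (d ∸ 1) ℕ.* r

column : ∀ {n d m} → Tableau n d m → Fin d → List (Maybe (Fin n))
column T j = toList (Vec.map (λ row → lookup row j) T)

countJust : ∀ {A : Set} → List (Maybe A) → ℕ
countJust xs = length (catMaybes xs)

isJellyfish : ∀ {n d m} (r : ℕ) → (Fin n → Fin d) → Tableau n d m → Bool
isJellyfish {n} {d} {m} r π T =
  all rowOK (toList (Vec.zip (Vec.allFin m) T)) ∧ all colOK (List.allFin d)
  where
  rowOK : Fin m × Vec (Maybe (Fin n)) d → Bool
  rowOK (k , row) with toℕ k ℕ.<? r
  ... | yes _ = all is-just (toList row)
  ... | no _ = ⌊ countJust (toList row) ℕ.≟ 1 ⌋
  colOK : Fin d → Bool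
  colOK j = ⌊ ≡-dec Fin._≟_ (catMaybes (column T j)) (block π j) ⌋

allVecs : ∀ {A : Set} (k : ℕ) → List A → List (Vec A k)
allVecs zero xs = [] ∷ []
allVecs (suc k) xs = concatMap (λ a → List.map (a ∷_) (allVecs k xs)) xs

allTableaux : (n d m : ℕ) → List (Tableau n d m)
allTableaux n d m = allVecs m (allVecs d (nothing ∷ List.map just (List.allFin n)))

jellyfish : ∀ {n d} (r : ℕ) → (Fin n → Fin d) → List (Tableau n d (jrows n d r))
jellyfish {n} {d} r π = filter (λ T → isJellyfish r π T Data.Bool.≟ true) (allTableaux n d (jrows n d r))

readingWord : ∀ {n d m} → Tableau n d m → List (Fin n)
readingWord T = concatMap (λ row → catMaybes (toList row)) (toList T)

rowSet : ∀ {n d m} → Tableau n d m → Fin d → List (Fin m)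
rowSet {m = m} T j = filter (λ k → is-just (lookup (lookup T k) j) Data.Bool.≟ true) (List.allFin m)

module WithRing {c ℓ} (R : CommutativeRing c ℓ) where
  open CommutativeRing R

  sum : List Carrier → Carrier
  sum = foldr _+_ 0#

  prod : List Carrier → Carrier
  prod = foldr _*_ 1#

  signR : ℕ → Carrier
  signR zero = 1#
  signR (suc k) = - signR k

  pow : Carrier → ℕ → Carrier
  pow x zero = 1#
  pow x (suc k) = x * pow x k

  sgnPerm : ∀ {d} → Permutation′ d → Carrier
  sgnPerm σ = signR (invPerm σ)

  picks : ∀ {A : Set} → List A → List (A × List A)
  picks [] = []
  picks (a ∷ as) = (a , as) ∷ List.map (λ { (b , bs) → (b , a ∷ bs) }) (picks as)

  -- minor M_I^J : determinant of the submatrix with rows I, columns J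
  -- (Laplace expansion along the first row; 0 if |I| ≠ |J|)
  minor : ∀ {n} → (Fin n → Fin n → Carrier) → List (Fin n) → List (Fin n) → Carrier
  minor M [] [] = 1#
  minor M [] (_ ∷ _) = 0#
  minor M (i ∷ I) J = go 0 (picks J)
    where
    go : ℕ → List (Fin _ × List (Fin _)) → Carrier
    go k [] = 0#
    go k ((a , rest) ∷ ps) = signR k * (M i a * minor M I rest) + go (suc k) ps

  -- J(T) = ∏_j M^{π_j}_{R_j(T)}  (rows R_j(T) ⊆ [n-(d-1)r] ⊆ [n], columns π_j)
  Jmon : ∀ {n d} (r : ℕ) → (Fin n → Fin n → Carrier) → (Fin n → Fin d) →
         Tableau n d (jrows n d r) → Carrier
  Jmon {n} {d} r M π T =
    prod (List.map (λ j → minor M (List.map (λ k → inject≤ k (m∸n≤m n ((d ∸ 1) ℕ.* r))) (rowSet T j)) (block π j))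
                   (List.allFin d))

  bracket : ∀ {n d} (r : ℕ) → (Fin n → Fin n → Carrier) → (Fin n → Fin d) → Carrier
  bracket r M π = sum (List.map (λ T → signR (invWord (readingWord T)) * Jmon r M π T) (jellyfish r π))

-- Permuting the columns of a tableau by σ is a bijection from J_r(π) onto J_r(σ(π)), and it
-- preserves J(T), which only gets its factors M^{π_j}_{R_j(T)} reordered. On the reading word it
-- permutes the entries inside each row. The first r rows are full and have distinct entries (they
-- lie in distinct blocks), and for a word w with distinct letters inv(w ∘ σ⁻¹) + inv(w) ≡ inv(σ)
-- mod 2, as one sees by comparing the contributions of each pair of positions. The remaining rows
-- have a single entry, and inversions between different rows only depend on the multisets of
-- letters of the rows. Hence sgn(T) = sgn(σ)^r sgn(σ T), and summing over J_r(π) gives the claim.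

module Submission where

open import Algebra.Bundles using (CommutativeRing)
open import Data.Bool as Bool using (Bool; true; false; not; _∧_; if_then_else_)
open import Data.Bool.ListAction using (all)
open import Data.Bool.Properties using (T-∧; ∧-isCommutativeMonoid)
open import Data.Fin as Fin using (Fin; toℕ)
open import Data.Fin.Permutation as Perm using (Permutation′; _⟨$⟩ʳ_; _⟨$⟩ˡ_)
open import Data.Fin.Properties using (_<?_; <-cmp; <-asym; <-irrefl)
open import Data.List as L using (List; []; _∷_; _++_; map; filter; length; tabulate; catMaybes)
import Data.List.Properties as L
open import Data.List.Membership.Propositional using (_∈_)
open import Data.List.Membership.Propositional.Properties
  using (∈-map⁺; ∈-map⁻; ∈-allFin; ∈-filter⁻; ∈-cartesianProductWith⁺)
open import Data.List.Membership.Propositional.Properties.WithK using (unique∧set⇒bag)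
open import Data.List.Relation.Binary.BagAndSetEquality using (∼bag⇒↭)
open import Data.List.Relation.Binary.Permutation.Propositional using (_↭_; ↭-refl; ↭-sym; ↭⇒↭ₛ′)
import Data.List.Relation.Binary.Permutation.Propositional.Properties as ↭
open import Data.List.Relation.Binary.Permutation.Setoid.Properties using (foldr-commMonoid)
import Data.List.Relation.Unary.All as All
import Data.List.Relation.Unary.All.Properties as All
import Data.List.Relation.Unary.AllPairs as AllPairs
open import Data.List.Relation.Unary.Any as Any using (here; there)
open import Data.List.Relation.Unary.Unique.Propositional using (Unique)
import Data.List.Relation.Unary.Unique.Propositional.Properties as Unique
open import Data.Maybe using (Maybe; just; nothing; is-just)
import Data.Maybe.Relation.Unary.Any as Maybe
open import Data.Nat as ℕ using (ℕ; zero; suc; _<_; _≤_; _⊓_; z≤n; s≤s)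
import Data.Nat.Properties as ℕ
open import Data.Product using (∃-syntax; _×_; _,_; proj₁; proj₂)
open import Data.Unit using (tt)
open import Data.Vec as V using (Vec; lookup; toList)
import Data.Vec.Properties as V
open import Data.Vec.Membership.Propositional using () renaming (_∈_ to _∈ᵥ_)
open import Data.Vec.Membership.Propositional.Properties using (∈-lookup; ∈-toList⁺)
open import Function using (_∘_)
open import Function.Bundles using (mk⇔; Injection; Equivalence)
open import Function.Definitions using (Injective)
open import Function.Properties.Inverse using (Inverse⇒Injection)
open import Relation.Binary.Definitions using (tri<; tri≈; tri>)
open import Relation.Binary.PropositionalEquality as ≡
  using (_≡_; refl; sym; trans; cong; cong₂; subst; subst₂; module ≡-Reasoning)
open import Relation.Nullary using (does; yes; no; ¬_; contradiction)
open import Relation.Nullary.Decidable using (⌊_⌋; toWitness; dec-true; dec-false)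

open import Defs

map-inverse-↭ : ∀ {A : Set} {xs : List A} (f g : A → A) →
  (∀ x → f (g x) ≡ x) → (∀ x → g (f x) ≡ x) → Unique xs → (∀ x → x ∈ xs) → map f xs ↭ xs
map-inverse-↭ {xs = xs} f g f∘g g∘f unique complete =
  ∼bag⇒↭ (unique∧set⇒bag (Unique.map⁺ f-injective unique) unique
    (λ {x} → mk⇔ (λ _ → complete x)
                 (λ _ → subst (_∈ map f xs) (f∘g x) (∈-map⁺ f (complete (g x))))))
  where
  f-injective : ∀ {x y} → f x ≡ f y → x ≡ y
  f-injective {x} {y} fx≡fy = trans (sym (g∘f x)) (trans (cong g fx≡fy) (g∘f y))

all-↭ : ∀ {A : Set} (p : A → Bool) {xs ys} → xs ↭ ys → all p xs ≡ all p ys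
all-↭ p xs↭ys =
  foldr-commMonoid (≡.setoid Bool) ∧-isCommutativeMonoid (↭⇒↭ₛ′ ≡.isEquivalence (↭.map⁺ p xs↭ys))

map-permutation-allFin : ∀ {d} (σ : Permutation′ d) → map (σ ⟨$⟩ˡ_) (L.allFin d) ↭ L.allFin d
map-permutation-allFin {d} σ =
  map-inverse-↭ _ _ (λ _ → Perm.inverseˡ σ) (λ _ → Perm.inverseʳ σ) (Unique.allFin⁺ d) ∈-allFin

module Inversions where
  open import Data.Nat using (_+_; _*_)
  import Data.Nat.ListAction as ℕ
  import Data.Nat.ListAction.Properties as ℕ
  open import Data.Nat.Tactic.RingSolver using (solve-∀)
  open import Algebra.Properties.Semiring.Sum ℕ.+-*-semiring
    using (sum-syntax; sum-cong-≗; ∑-distrib-+; ∑-comm; ∑-permute; *-distribˡ-sum)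

  𝟙 : Bool → ℕ
  𝟙 true = 1
  𝟙 false = 0

  ⟦_<_⟧ : ∀ {k l} → Fin k → Fin l → ℕ
  ⟦ a < b ⟧ = 𝟙 (does (a <? b))

  inversions : ∀ {d n} → (Fin d → Fin n) → ℕ
  inversions {d} f = ∑[ a < d ] (∑[ b < d ] (⟦ a < b ⟧ * ⟦ f b < f a ⟧))

  length-filter-< : ∀ {d n} (g : Fin d → Fin n) (x : Fin n) →
    length (filter (_<? x) (tabulate g)) ≡ ∑[ b < d ] ⟦ g b < x ⟧
  length-filter-< {zero} g x = refl
  length-filter-< {suc d} g x with does (g Fin.zero <? x)
  ... | true = cong suc (length-filter-< (g ∘ Fin.suc) x)
  ... | false = length-filter-< (g ∘ Fin.suc) x

  invWord-tabulate : ∀ {d n} (f : Fin d → Fin n) → invWord (tabulate f) ≡ inversions f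
  invWord-tabulate {zero} f = refl
  invWord-tabulate {suc d} f = cong₂ _+_
    (trans (length-filter-< (f ∘ Fin.suc) (f Fin.zero))
           (sum-cong-≗ (λ b → sym (ℕ.*-identityˡ ⟦ f (Fin.suc b) < f Fin.zero ⟧))))
    (invWord-tabulate (f ∘ Fin.suc))

  ∑∑-transpose-+ : ∀ {d} (h : Fin d → Fin d → ℕ) →
    ∑[ a < d ] (∑[ b < d ] (h a b + h b a)) ≡ 2 * ∑[ a < d ] (∑[ b < d ] h a b)
  ∑∑-transpose-+ {d} h = begin
    ∑[ a < d ] (∑[ b < d ] (h a b + h b a))
      ≡⟨ sum-cong-≗ (λ a → ∑-distrib-+ (h a) (λ b → h b a)) ⟩
    ∑[ a < d ] (∑[ b < d ] h a b + ∑[ b < d ] h b a)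
      ≡⟨ ∑-distrib-+ (λ a → ∑[ b < d ] h a b) (λ a → ∑[ b < d ] h b a) ⟩
    ∑[ a < d ] (∑[ b < d ] h a b) + ∑[ a < d ] (∑[ b < d ] h b a)
      ≡⟨ cong (∑[ a < d ] (∑[ b < d ] h a b) +_) (sym (∑-comm h)) ⟩
    ∑[ a < d ] (∑[ b < d ] h a b) + ∑[ a < d ] (∑[ b < d ] h a b)
      ≡⟨ cong (∑[ a < d ] (∑[ b < d ] h a b) +_) (sym (ℕ.+-identityʳ _)) ⟩
    2 * ∑[ a < d ] (∑[ b < d ] h a b) ∎
    where open ≡-Reasoning

  ∑∑-cong-symmetrised : ∀ {d} (h h′ : Fin d → Fin d → ℕ) →
    (∀ a b → h a b + h b a ≡ h′ a b + h′ b a) →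
    ∑[ a < d ] (∑[ b < d ] h a b) ≡ ∑[ a < d ] (∑[ b < d ] h′ a b)
  ∑∑-cong-symmetrised h h′ eq = ℕ.*-cancelˡ-≡ _ _ 2
    (trans (sym (∑∑-transpose-+ h))
      (trans (sum-cong-≗ (λ a → sum-cong-≗ (eq a))) (∑∑-transpose-+ h′)))

  inversions-∘-permutation : ∀ {d n} (σ : Permutation′ d) (f : Fin d → Fin n) →
    inversions (f ∘ (σ ⟨$⟩ˡ_)) ≡ ∑[ a < d ] (∑[ b < d ] (⟦ σ ⟨$⟩ʳ a < σ ⟨$⟩ʳ b ⟧ * ⟦ f b < f a ⟧))
  inversions-∘-permutation {d} σ f = begin
    ∑[ a < d ] (∑[ b < d ] (⟦ a < b ⟧ * ⟦ f (ρ b) < f (ρ a) ⟧))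
      ≡⟨ sum-cong-≗ (λ a → sum-cong-≗ (λ b → cong₂ (λ x y → ⟦ x < y ⟧ * ⟦ f (ρ b) < f (ρ a) ⟧)
           (sym (Perm.inverseʳ σ)) (sym (Perm.inverseʳ σ)))) ⟩
    ∑[ a < d ] (∑[ b < d ] g (ρ a) (ρ b))
      ≡⟨ sum-cong-≗ (λ a → sym (∑-permute (g (ρ a)) (Perm.flip σ))) ⟩
    ∑[ a < d ] (∑[ b < d ] g (ρ a) b)
      ≡⟨ sym (∑-permute (λ a → ∑[ b < d ] g a b) (Perm.flip σ)) ⟩
    ∑[ a < d ] (∑[ b < d ] g a b) ∎
    where
    open ≡-Reasoning
    ρ = σ ⟨$⟩ˡ_
    g : Fin d → Fin d → ℕ
    g a b = ⟦ σ ⟨$⟩ʳ a < σ ⟨$⟩ʳ b ⟧ * ⟦ f b < f a ⟧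

  does-<-flip : ∀ {k} {a b : Fin k} → ¬ a ≡ b → does (b <? a) ≡ not (does (a <? b))
  does-<-flip {a = a} {b} a≢b with <-cmp a b
  ... | tri< a<b _ _ = trans (dec-false (b <? a) (<-asym a<b)) (cong not (sym (dec-true (a <? b) a<b)))
  ... | tri≈ _ a≡b _ = contradiction a≡b a≢b
  ... | tri> _ _ b<a = trans (dec-true (b <? a) b<a) (cong not (sym (dec-false (a <? b) (<-asym b<a))))

  -- With x, p and v recording whether a < b, σ a < σ b and f b < f a for a pair a ≠ b, the two
  -- sides are the contributions of {a, b} to inversions (f ∘ σ⁻¹) + inversions f and to
  -- inversions σ + 2 k.
  pair-parity : ∀ x p v →
    (𝟙 p * 𝟙 v + 𝟙 x * 𝟙 v) + (𝟙 (not p) * 𝟙 (not v) + 𝟙 (not x) * 𝟙 (not v)) ≡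
    (𝟙 x * 𝟙 (not p) + 2 * (𝟙 x * 𝟙 v * 𝟙 p)) +
    (𝟙 (not x) * 𝟙 p + 2 * (𝟙 (not x) * 𝟙 (not v) * 𝟙 (not p)))
  pair-parity true  true  true  = refl
  pair-parity true  true  false = refl
  pair-parity true  false true  = refl
  pair-parity true  false false = refl
  pair-parity false true  true  = refl
  pair-parity false true  false = refl
  pair-parity false false true  = refl
  pair-parity false false false = refl

  inversions-∘-permutation-parity : ∀ {d n} (σ : Permutation′ d) (f : Fin d → Fin n) →
    Injective _≡_ _≡_ f →
    ∃[ k ] inversions (f ∘ (σ ⟨$⟩ˡ_)) + inversions f ≡ inversions (σ ⟨$⟩ʳ_) + 2 * k
  inversions-∘-permutation-parity {d} σ f f-injective = ∑[ a < d ] (∑[ b < d ] s a b) , (begin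
    inversions (f ∘ (σ ⟨$⟩ˡ_)) + inversions f
      ≡⟨ cong (_+ inversions f) (inversions-∘-permutation σ f) ⟩
    ∑[ a < d ] (∑[ b < d ] φ a b) + ∑[ a < d ] (∑[ b < d ] ι a b)
      ≡⟨ ∑∑-distrib-+ φ ι ⟨
    ∑[ a < d ] (∑[ b < d ] (φ a b + ι a b))
      ≡⟨ ∑∑-cong-symmetrised _ _ pair ⟩
    ∑[ a < d ] (∑[ b < d ] (κ a b + 2 * s a b))
      ≡⟨ ∑∑-distrib-+ κ (λ a b → 2 * s a b) ⟩
    inversions ρ′ + ∑[ a < d ] (∑[ b < d ] (2 * s a b))
      ≡⟨ cong (inversions ρ′ +_) (sym (trans (*-distribˡ-sum 2 (λ a → ∑[ b < d ] s a b))
                                             (sum-cong-≗ (λ a → *-distribˡ-sum 2 (s a))))) ⟩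
    inversions ρ′ + 2 * ∑[ a < d ] (∑[ b < d ] s a b) ∎)
    where
    open ≡-Reasoning
    ρ′ = σ ⟨$⟩ʳ_
    φ ι κ s : Fin d → Fin d → ℕ
    φ a b = ⟦ ρ′ a < ρ′ b ⟧ * ⟦ f b < f a ⟧
    ι a b = ⟦ a < b ⟧ * ⟦ f b < f a ⟧
    κ a b = ⟦ a < b ⟧ * ⟦ ρ′ b < ρ′ a ⟧
    s a b = ⟦ a < b ⟧ * ⟦ f b < f a ⟧ * ⟦ ρ′ a < ρ′ b ⟧

    ∑∑-distrib-+ : (h h′ : Fin d → Fin d → ℕ) →
      ∑[ a < d ] (∑[ b < d ] (h a b + h′ a b)) ≡
      ∑[ a < d ] (∑[ b < d ] h a b) + ∑[ a < d ] (∑[ b < d ] h′ a b)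
    ∑∑-distrib-+ h h′ = trans (sum-cong-≗ (λ a → ∑-distrib-+ (h a) (h′ a)))
      (∑-distrib-+ (λ a → ∑[ b < d ] h a b) (λ a → ∑[ b < d ] h′ a b))

    pair : ∀ a b → (φ a b + ι a b) + (φ b a + ι b a) ≡ (κ a b + 2 * s a b) + (κ b a + 2 * s b a)
    pair a b with a Fin.≟ b
    ... | yes refl rewrite dec-false (a <? a) (<-irrefl refl) | dec-false (ρ′ a <? ρ′ a) (<-irrefl refl) = refl
    ... | no a≢b rewrite does-<-flip a≢b | does-<-flip (a≢b ∘ Injection.injective (Inverse⇒Injection σ))
                       | does-<-flip {a = f b} {f a} (a≢b ∘ sym ∘ f-injective)
      = pair-parity (does (a <? b)) (does (ρ′ a <? ρ′ b)) (does (f b <? f a))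

  crossInversions : ∀ {n} → List (Fin n) → List (Fin n) → ℕ
  crossInversions xs ys = ℕ.sum (map (λ x → length (filter (_<? x) ys)) xs)

  invWord-++ : ∀ {n} (xs ys : List (Fin n)) →
    invWord (xs ++ ys) ≡ invWord xs + invWord ys + crossInversions xs ys
  invWord-++ [] ys = sym (ℕ.+-identityʳ _)
  invWord-++ (x ∷ xs) ys = begin
    length (filter (_<? x) (xs ++ ys)) + invWord (xs ++ ys)
      ≡⟨ cong₂ _+_ (trans (cong length (L.filter-++ (_<? x) xs ys)) (L.length-++ (filter (_<? x) xs)))
                   (invWord-++ xs ys) ⟩
    (below xs + below ys) + (invWord xs + invWord ys + crossInversions xs ys)
      ≡⟨ regroup (below xs) (below ys) (invWord xs) (invWord ys) (crossInversions xs ys) ⟩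
    (below xs + invWord xs) + invWord ys + (below ys + crossInversions xs ys) ∎
    where
    open ≡-Reasoning
    below : List (Fin _) → ℕ
    below zs = length (filter (_<? x) zs)
    regroup : ∀ a b c e x → (a + b) + (c + e + x) ≡ a + c + e + (b + x)
    regroup = solve-∀

  crossInversions-↭ : ∀ {n} {xs xs′ ys ys′ : List (Fin n)} → xs ↭ xs′ → ys ↭ ys′ →
    crossInversions xs ys ≡ crossInversions xs′ ys′
  crossInversions-↭ {xs = xs} xs↭xs′ ys↭ys′ = trans
    (cong ℕ.sum (L.map-cong (λ x → ↭.↭-length (↭.filter-↭ (_<? x) ys↭ys′)) xs))
    (ℕ.sum-↭ (↭.map⁺ _ xs↭xs′))

open Inversions

permuteRow : ∀ {A : Set} {d} → Permutation′ d → Vec A d → Vec A d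
permuteRow σ row = V.tabulate (lookup row ∘ (σ ⟨$⟩ˡ_))

lookup-permuteRow : ∀ {A : Set} {d} (σ : Permutation′ d) (row : Vec A d) j →
  lookup (permuteRow σ row) j ≡ lookup row (σ ⟨$⟩ˡ j)
lookup-permuteRow σ row = V.lookup∘tabulate (lookup row ∘ (σ ⟨$⟩ˡ_))

permuteRow-flip : ∀ {A : Set} {d} (σ : Permutation′ d) (row : Vec A d) →
  permuteRow (Perm.flip σ) (permuteRow σ row) ≡ row
permuteRow-flip σ row = trans
  (V.tabulate-cong (λ j → trans (lookup-permuteRow σ row (σ ⟨$⟩ʳ j)) (cong (lookup row) (Perm.inverseˡ σ))))
  (V.tabulate∘lookup row)

toList-tabulate : ∀ {A : Set} {k} (g : Fin k → A) → toList (V.tabulate g) ≡ tabulate g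
toList-tabulate {k = zero} g = refl
toList-tabulate {k = suc k} g = cong (g Fin.zero ∷_) (toList-tabulate (g ∘ Fin.suc))

toList-permuteRow : ∀ {A : Set} {d} (σ : Permutation′ d) (row : Vec A d) →
  toList (permuteRow σ row) ↭ toList row
toList-permuteRow {d = d} σ row =
  subst₂ _↭_ (sym listed) unpermuted (↭.map⁺ (lookup row) (map-permutation-allFin σ))
  where
  open ≡-Reasoning
  listed : toList (permuteRow σ row) ≡ map (lookup row) (map (σ ⟨$⟩ˡ_) (L.allFin d))
  listed = begin
    toList (permuteRow σ row)
      ≡⟨ toList-tabulate _ ⟩
    tabulate (lookup row ∘ (σ ⟨$⟩ˡ_))
      ≡⟨ L.map-tabulate (σ ⟨$⟩ˡ_) (lookup row) ⟨
    map (lookup row) (tabulate (σ ⟨$⟩ˡ_))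
      ≡⟨ cong (map (lookup row)) (L.map-tabulate (λ j → j) (σ ⟨$⟩ˡ_)) ⟨
    map (lookup row) (map (σ ⟨$⟩ˡ_) (L.allFin d)) ∎
  unpermuted : map (lookup row) (L.allFin d) ≡ toList row
  unpermuted = begin
    map (lookup row) (L.allFin d)          ≡⟨ L.map-tabulate (λ j → j) (lookup row) ⟩
    tabulate (lookup row)                  ≡⟨ toList-tabulate (lookup row) ⟨
    toList (V.tabulate (lookup row))       ≡⟨ cong toList (V.tabulate∘lookup row) ⟩
    toList row                             ∎

permuteColumns : ∀ {n d m} → Permutation′ d → Tableau n d m → Tableau n d m
permuteColumns σ = V.map (permuteRow σ)

permuteColumns-flip : ∀ {n d m} (σ : Permutation′ d) (T : Tableau n d m) →
  permuteColumns (Perm.flip σ) (permuteColumns σ T) ≡ T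
permuteColumns-flip σ T =
  trans (sym (V.map-∘ _ _ T)) (trans (V.map-cong (permuteRow-flip σ) T) (V.map-id T))

allVecs-cartesianProduct : ∀ {A : Set} k (xs : List A) →
  allVecs (suc k) xs ≡ L.cartesianProductWith V._∷_ xs (allVecs k xs)
allVecs-cartesianProduct k [] = refl
allVecs-cartesianProduct k (x ∷ xs) = cong (map (x V.∷_) (allVecs k (x ∷ xs)) ++_) (prefix xs)
  where
  prefix : ∀ ys → L.concatMap (λ a → map (a V.∷_) (allVecs k (x ∷ xs))) ys
                ≡ L.cartesianProductWith V._∷_ ys (allVecs k (x ∷ xs))
  prefix [] = refl
  prefix (y ∷ ys) = cong (map (y V.∷_) (allVecs k (x ∷ xs)) ++_) (prefix ys)

allVecs-unique : ∀ {A : Set} k {xs : List A} → Unique xs → Unique (allVecs k xs)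
allVecs-unique zero _ = All.[] AllPairs.∷ AllPairs.[]
allVecs-unique (suc k) {xs} unique = subst Unique (sym (allVecs-cartesianProduct k xs))
  (Unique.cartesianProductWith⁺ V._∷_ (λ e → V.∷-injectiveˡ e , V.∷-injectiveʳ e)
    unique (allVecs-unique k unique))

allVecs-complete : ∀ {A : Set} k {xs : List A} → (∀ x → x ∈ xs) → ∀ v → v ∈ allVecs k xs
allVecs-complete zero complete V.[] = here refl
allVecs-complete (suc k) {xs} complete (x V.∷ v) = subst (x V.∷ v ∈_) (sym (allVecs-cartesianProduct k xs))
  (∈-cartesianProductWith⁺ V._∷_ (complete x) (allVecs-complete k complete v))

cells-unique : ∀ n → Unique (nothing ∷ map just (L.allFin n))
cells-unique n = All.tabulate nothing∉ AllPairs.∷ Unique.map⁺ just-injective (Unique.allFin⁺ n)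
  where
  just-injective : ∀ {x y : Fin n} → just x ≡ just y → x ≡ y
  just-injective refl = refl
  nothing∉ : ∀ {c} → c ∈ map just (L.allFin n) → ¬ nothing ≡ c
  nothing∉ c∈ refl with ∈-map⁻ just c∈
  ... | _ , _ , ()

cells-complete : ∀ n (c : Maybe (Fin n)) → c ∈ nothing ∷ map just (L.allFin n)
cells-complete n nothing = here refl
cells-complete n (just x) = there (∈-map⁺ just (∈-allFin x))

map-permuteColumns-allTableaux : ∀ n {d} m (σ : Permutation′ d) →
  map (permuteColumns σ) (allTableaux n d m) ↭ allTableaux n d m
map-permuteColumns-allTableaux n {d} m σ = map-inverse-↭ _ (permuteColumns (Perm.flip σ))
  (permuteColumns-flip (Perm.flip σ)) (permuteColumns-flip σ)
  (allVecs-unique m (allVecs-unique d (cells-unique n)))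
  (allVecs-complete m (allVecs-complete d (cells-complete n)))

rowCondition : ∀ {n d m} → ℕ → Fin m × Vec (Maybe (Fin n)) d → Bool
rowCondition r (k , row) with toℕ k ℕ.<? r
... | yes _ = all is-just (toList row)
... | no _ = ⌊ countJust (toList row) ℕ.≟ 1 ⌋

columnCondition : ∀ {n d m} → (Fin n → Fin d) → Tableau n d m → Fin d → Bool
columnCondition π T j = ⌊ L.≡-dec Fin._≟_ (catMaybes (column T j)) (block π j) ⌋

-- The row test of isJellyfish is bound in a where clause; the let captures it by unification.
rowTest-≡-rowCondition : ∀ {n d m} r (π : Fin n → Fin d) (T : Tableau n d m) k row →
  let rowTest : Fin m × Vec (Maybe (Fin n)) d → Bool
      rowTest = _
      unfolds : isJellyfish r π T ≡
                all rowTest (toList (V.zip (V.allFin m) T)) ∧ all (columnCondition π T) (L.allFin d)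
      unfolds = refl
  in rowTest (k , row) ≡ rowCondition r (k , row)
rowTest-≡-rowCondition r π T k row with toℕ k ℕ.<? r
... | yes _ = refl
... | no _ = refl

isJellyfish-≡ : ∀ {n d m} r (π : Fin n → Fin d) (T : Tableau n d m) →
  isJellyfish r π T ≡
  all (rowCondition r) (toList (V.zip (V.allFin m) T)) ∧ all (columnCondition π T) (L.allFin d)
isJellyfish-≡ {d = d} {m} r π T =
  cong (λ rows → L.foldr _∧_ true rows ∧ all (columnCondition π T) (L.allFin d)) (L.map-cong (λ (k , row) → rowTest-≡-rowCondition r π T k row) (toList (V.zip (V.allFin m) T)))

rowCondition-permuteRow : ∀ {n d m} r (σ : Permutation′ d) (k : Fin m) (row : Vec (Maybe (Fin n)) d) →
  rowCondition r (k , permuteRow σ row) ≡ rowCondition r (k , row)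
rowCondition-permuteRow r σ k row with toℕ k ℕ.<? r
... | yes _ = all-↭ is-just (toList-permuteRow σ row)
... | no _ = cong (λ c → ⌊ c ℕ.≟ 1 ⌋) (↭.↭-length (↭.catMaybes-↭ (toList-permuteRow σ row)))

rowConditions-permuteColumns : ∀ {n d m l} r (σ : Permutation′ d) (ks : Vec (Fin m) l) (T : Tableau n d l) →
  all (rowCondition r) (toList (V.zip ks (permuteColumns σ T))) ≡ all (rowCondition r) (toList (V.zip ks T))
rowConditions-permuteColumns r σ V.[] V.[] = refl
rowConditions-permuteColumns r σ (k V.∷ ks) (row V.∷ T) =
  cong₂ _∧_ (rowCondition-permuteRow r σ k row) (rowConditions-permuteColumns r σ ks T)

column-permuteColumns : ∀ {n d m} (σ : Permutation′ d) (T : Tableau n d m) j →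
  column (permuteColumns σ T) j ≡ column T (σ ⟨$⟩ˡ j)
column-permuteColumns σ T j = cong toList (trans (sym (V.map-∘ (λ row → lookup row j) (permuteRow σ) T))
                                                 (V.map-cong (λ row → lookup-permuteRow σ row j) T))

rowSet-permuteColumns : ∀ {n d m} (σ : Permutation′ d) (T : Tableau n d m) j →
  rowSet (permuteColumns σ T) j ≡ rowSet T (σ ⟨$⟩ˡ j)
rowSet-permuteColumns {m = m} σ T j =
  L.filter-≐ _ _ (subst P (entry≡ _) , subst P (sym (entry≡ _))) (L.allFin m)
  where
  P : Maybe _ → Set
  P c = is-just c ≡ true
  entry≡ : ∀ k → lookup (lookup (permuteColumns σ T) k) j ≡ lookup (lookup T k) (σ ⟨$⟩ˡ j)
  entry≡ k = trans (cong (λ row → lookup row j) (V.lookup-map k (permuteRow σ) T))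
                   (lookup-permuteRow σ (lookup T k) j)

block-relabel : ∀ {n d} (σ : Permutation′ d) (π π′ : Fin n → Fin d) → (∀ x → π′ x ≡ σ ⟨$⟩ʳ π x) →
  ∀ j → block π′ j ≡ block π (σ ⟨$⟩ˡ j)
block-relabel {n} σ π π′ π′≡σπ j = L.filter-≐ _ _ (to , from) (L.allFin n)
  where
  to : ∀ {x} → π′ x ≡ j → π x ≡ σ ⟨$⟩ˡ j
  to {x} π′x≡j = trans (sym (Perm.inverseˡ σ)) (cong (σ ⟨$⟩ˡ_) (trans (sym (π′≡σπ x)) π′x≡j))
  from : ∀ {x} → π x ≡ σ ⟨$⟩ˡ j → π′ x ≡ j
  from {x} πx≡ = trans (π′≡σπ x) (trans (cong (σ ⟨$⟩ʳ_) πx≡) (Perm.inverseʳ σ))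

isJellyfish-permuteColumns : ∀ {n d m} r (σ : Permutation′ d) (π π′ : Fin n → Fin d) →
  (∀ x → π′ x ≡ σ ⟨$⟩ʳ π x) → (T : Tableau n d m) →
  isJellyfish r π′ (permuteColumns σ T) ≡ isJellyfish r π T
isJellyfish-permuteColumns {d = d} {m} r σ π π′ π′≡σπ T = begin
  isJellyfish r π′ (permuteColumns σ T)
    ≡⟨ isJellyfish-≡ r π′ (permuteColumns σ T) ⟩
  all (rowCondition r) (toList (V.zip (V.allFin m) (permuteColumns σ T))) ∧
  all (columnCondition π′ (permuteColumns σ T)) (L.allFin d)
    ≡⟨ cong₂ _∧_ (rowConditions-permuteColumns r σ (V.allFin m) T) columns ⟩
  all (rowCondition r) (toList (V.zip (V.allFin m) T)) ∧ all (columnCondition π T) (L.allFin d)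
    ≡⟨ isJellyfish-≡ r π T ⟨
  isJellyfish r π T ∎
  where
  open ≡-Reasoning
  columns : all (columnCondition π′ (permuteColumns σ T)) (L.allFin d) ≡ all (columnCondition π T) (L.allFin d)
  columns = begin
    all (columnCondition π′ (permuteColumns σ T)) (L.allFin d)
      ≡⟨ cong (L.foldr _∧_ true) (L.map-cong (λ j → cong₂ (λ col blk → ⌊ L.≡-dec Fin._≟_ (catMaybes col) blk ⌋)
           (column-permuteColumns σ T j) (block-relabel σ π π′ π′≡σπ j)) (L.allFin d)) ⟩
    all (columnCondition π T ∘ (σ ⟨$⟩ˡ_)) (L.allFin d)
      ≡⟨ cong (L.foldr _∧_ true) (L.map-∘ (L.allFin d)) ⟩
    all (columnCondition π T) (map (σ ⟨$⟩ˡ_) (L.allFin d))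
      ≡⟨ all-↭ (columnCondition π T) (map-permutation-allFin σ) ⟩
    all (columnCondition π T) (L.allFin d) ∎

rowCondition⇒full : ∀ {n d m} {r} {k : Fin m} {row : Vec (Maybe (Fin n)) d} → toℕ k < r →
  Bool.T (rowCondition r (k , row)) → Bool.T (all is-just (toList row))
rowCondition⇒full {r = r} {k} k<r holds with toℕ k ℕ.<? r
... | yes _ = holds
... | no k≮r = contradiction k<r k≮r

rowCondition⇒singleton : ∀ {n d m} {r} {k : Fin m} {row : Vec (Maybe (Fin n)) d} → ¬ toℕ k < r →
  Bool.T (rowCondition r (k , row)) → countJust (toList row) ≡ 1
rowCondition⇒singleton {r = r} {k} k≮r holds with toℕ k ℕ.<? r
... | yes k<r = contradiction k<r k≮r
... | no _ = toWitness holds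

full-tabulate : ∀ {A : Set} {k} (row : Vec (Maybe A) k) → Bool.T (all is-just (toList row)) →
  ∃[ f ] row ≡ V.tabulate (just ∘ f)
full-tabulate V.[] _ = (λ ()) , refl
full-tabulate (just a V.∷ row) full with full-tabulate row full
... | f , refl = (λ { Fin.zero → a ; (Fin.suc i) → f i }) , refl

∈-zip-allFin : ∀ {A : Set} {m} (T : Vec A m) k → (k , lookup T k) ∈ toList (V.zip (V.allFin m) T)
∈-zip-allFin {m = m} T k = ∈-toList⁺ (subst (_∈ᵥ V.zip (V.allFin m) T)
  (trans (V.lookup-zip k (V.allFin m) T) (cong (_, lookup T k) (V.lookup-allFin k)))
  (∈-lookup k (V.zip (V.allFin m) T)))

InjectiveFullRow : ∀ {n d} → Vec (Maybe (Fin n)) d → Set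
InjectiveFullRow row = ∃[ f ] row ≡ V.tabulate (just ∘ f) × Injective _≡_ _≡_ f

module JellyfishRows {n d m} (r : ℕ) (π : Fin n → Fin d) (T : Tableau n d m)
                     (jelly : isJellyfish r π T ≡ true) where

  private
    conditions : Bool.T (all (rowCondition r) (toList (V.zip (V.allFin m) T))) ×
                 Bool.T (all (columnCondition π T) (L.allFin d))
    conditions = Equivalence.to T-∧ (subst Bool.T (trans (sym jelly) (isJellyfish-≡ r π T)) tt)

  rowCondition-holds : ∀ k → Bool.T (rowCondition r (k , lookup T k))
  rowCondition-holds k = All.lookup (All.all⁺ (rowCondition r) _ (proj₁ conditions)) (∈-zip-allFin T k)

  column≡block : ∀ j → catMaybes (column T j) ≡ block π j
  column≡block j = toWitness (All.lookup (All.all⁺ (columnCondition π T) _ (proj₂ conditions)) (∈-allFin j))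

  entry-in-block : ∀ k j {x} → lookup (lookup T k) j ≡ just x → π x ≡ j
  entry-in-block k j {x} entry = proj₂ (∈-filter⁻ (λ y → π y Fin.≟ j) {xs = L.allFin n}
    (subst (x ∈_) (column≡block j) (L.Any-catMaybes⁺ (Any.map (λ { refl → Maybe.just refl }) entry∈column))))
    where
    entry∈column : just x ∈ column T j
    entry∈column = ∈-toList⁺ (subst (_∈ᵥ V.map (λ row → lookup row j) T)
      (trans (V.lookup-map k (λ row → lookup row j) T) entry) (∈-lookup k (V.map (λ row → lookup row j) T)))

  full-rows : ∀ k → toℕ k < r → InjectiveFullRow (lookup T k)
  full-rows k k<r with full-tabulate (lookup T k) (rowCondition⇒full k<r (rowCondition-holds k))
  ... | f , row≡ = f , row≡ , λ {a} {b} fa≡fb →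
    trans (sym (entry-in-block k a (entry a))) (trans (cong π fa≡fb) (entry-in-block k b (entry b)))
    where
    entry : ∀ a → lookup (lookup T k) a ≡ just (f a)
    entry a = trans (cong (λ row → lookup row a) row≡) (V.lookup∘tabulate (just ∘ f) a)

  singleton-rows : ∀ k → ¬ toℕ k < r → countJust (toList (lookup T k)) ≡ 1
  singleton-rows k k≮r = rowCondition⇒singleton k≮r (rowCondition-holds k)

  r≤rows : Fin d → InOP n d r π → r ≤ m
  r≤rows j op = begin
    r                                ≤⟨ proj₂ (op j) ⟩
    length (block π j)               ≡⟨ cong length (column≡block j) ⟨
    length (catMaybes (column T j))  ≤⟨ L.length-catMaybes (column T j) ⟩
    length (column T j)              ≡⟨ V.length-toList (V.map (λ row → lookup row j) T) ⟩
    m                                ∎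
    where open ℕ.≤-Reasoning

rowWord : ∀ {n d} → Vec (Maybe (Fin n)) d → List (Fin n)
rowWord row = catMaybes (toList row)

readingWord-permuteColumns : ∀ {n d l} (σ : Permutation′ d) (T : Tableau n d l) →
  readingWord (permuteColumns σ T) ↭ readingWord T
readingWord-permuteColumns σ V.[] = ↭-refl
readingWord-permuteColumns σ (row V.∷ T) =
  ↭.++⁺ (↭.catMaybes-↭ (toList-permuteRow σ row)) (readingWord-permuteColumns σ T)

rowWord-tabulate : ∀ {n d} (f : Fin d → Fin n) → rowWord (V.tabulate (just ∘ f)) ≡ tabulate f
rowWord-tabulate f = trans (cong catMaybes (toList-tabulate (just ∘ f))) (catMaybes-just f)
  where
  catMaybes-just : ∀ {k} (g : Fin k → _) → catMaybes (tabulate (just ∘ g)) ≡ tabulate g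
  catMaybes-just {zero} g = refl
  catMaybes-just {suc k} g = cong (g Fin.zero ∷_) (catMaybes-just (g ∘ Fin.suc))

permuteRow-tabulate : ∀ {A : Set} {d} (σ : Permutation′ d) (g : Fin d → A) →
  permuteRow σ (V.tabulate g) ≡ V.tabulate (g ∘ (σ ⟨$⟩ˡ_))
permuteRow-tabulate σ g = V.tabulate-cong (λ j → V.lookup∘tabulate g (σ ⟨$⟩ˡ j))

invWord-rowWord-tabulate : ∀ {n d} (f : Fin d → Fin n) → invWord (rowWord (V.tabulate (just ∘ f))) ≡ inversions f
invWord-rowWord-tabulate f = trans (cong invWord (rowWord-tabulate f)) (invWord-tabulate f)

invWord-singleton : ∀ {n} (w : List (Fin n)) → length w ≡ 1 → invWord w ≡ 0
invWord-singleton (x ∷ []) _ = refl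

module _ {c ℓ} (R : CommutativeRing c ℓ) where
  open CommutativeRing R hiding (zero) renaming (refl to ≈-refl; sym to ≈-sym; trans to ≈-trans)
  open WithRing R
  open import Algebra.Properties.Ring ring using (-‿distribˡ-*; -‿distribʳ-*; -‿involutive)
  open import Algebra.Solver.CommutativeMonoid *-commutativeMonoid using (solve; _⊕_; _⊜_)
  open import Relation.Binary.Reasoning.Setoid setoid

  signR-+ : ∀ a b → signR (a ℕ.+ b) ≈ signR a * signR b
  signR-+ zero b = ≈-sym (*-identityˡ _)
  signR-+ (suc a) b = begin
    - signR (a ℕ.+ b)      ≈⟨ -‿cong (signR-+ a b) ⟩
    - (signR a * signR b)  ≈⟨ -‿distribˡ-* _ _ ⟩
    - signR a * signR b    ∎

  signR-square : ∀ a → signR a * signR a ≈ 1#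
  signR-square zero = *-identityˡ _
  signR-square (suc a) = begin
    - signR a * - signR a     ≈⟨ -‿distribˡ-* _ _ ⟨
    - (signR a * - signR a)   ≈⟨ -‿cong (-‿distribʳ-* _ _) ⟨
    - - (signR a * signR a)   ≈⟨ -‿involutive _ ⟩
    signR a * signR a         ≈⟨ signR-square a ⟩
    1#                        ∎

  signR-even : ∀ k → signR (2 ℕ.* k) ≈ 1#
  signR-even k = begin
    signR (k ℕ.+ (k ℕ.+ 0))  ≈⟨ signR-+ k (k ℕ.+ 0) ⟩
    signR k * signR (k ℕ.+ 0) ≡⟨ cong (λ k′ → signR k * signR k′) (ℕ.+-identityʳ k) ⟩
    signR k * signR k        ≈⟨ signR-square k ⟩
    1#                       ∎

  pow-1# : ∀ k → pow 1# k ≈ 1#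
  pow-1# zero = ≈-refl
  pow-1# (suc k) = ≈-trans (*-identityˡ _) (pow-1# k)

  sum-↭ : ∀ {xs ys} → xs ↭ ys → sum xs ≈ sum ys
  sum-↭ xs↭ys = foldr-commMonoid setoid +-isCommutativeMonoid (↭⇒↭ₛ′ isEquivalence xs↭ys)

  prod-↭ : ∀ {xs ys} → xs ↭ ys → prod xs ≈ prod ys
  prod-↭ xs↭ys = foldr-commMonoid setoid *-isCommutativeMonoid (↭⇒↭ₛ′ isEquivalence xs↭ys)

  sgnPerm≡signR-inversions : ∀ {d} (σ : Permutation′ d) → sgnPerm σ ≡ signR (inversions (σ ⟨$⟩ʳ_))
  sgnPerm≡signR-inversions σ =
    cong signR (trans (cong invWord (L.map-tabulate (λ j → j) (σ ⟨$⟩ʳ_))) (invWord-tabulate (σ ⟨$⟩ʳ_)))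

  signR-inversions-∘-permutation : ∀ {d n} (σ : Permutation′ d) (f : Fin d → Fin n) → Injective _≡_ _≡_ f →
    signR (inversions f) ≈ sgnPerm σ * signR (inversions (f ∘ (σ ⟨$⟩ˡ_)))
  signR-inversions-∘-permutation σ f f-injective = begin
    ε                 ≈⟨ *-identityˡ ε ⟨
    1# * ε            ≈⟨ *-congʳ (signR-square (inversions (f ∘ (σ ⟨$⟩ˡ_)))) ⟨
    (ε′ * ε′) * ε     ≈⟨ solve 2 (λ x y → (y ⊕ y) ⊕ x ⊜ (y ⊕ x) ⊕ y) ≈-refl ε ε′ ⟩
    (ε′ * ε) * ε′     ≈⟨ *-congʳ product≈sgn ⟩
    sgnPerm σ * ε′    ∎
    where
    ε = signR (inversions f)
    ε′ = signR (inversions (f ∘ (σ ⟨$⟩ˡ_)))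
    parity = inversions-∘-permutation-parity σ f f-injective
    k = proj₁ parity
    product≈sgn : ε′ * ε ≈ sgnPerm σ
    product≈sgn = begin
      ε′ * ε                                         ≈⟨ signR-+ (inversions (f ∘ (σ ⟨$⟩ˡ_))) (inversions f) ⟨
      signR (inversions (f ∘ (σ ⟨$⟩ˡ_)) ℕ.+ inversions f)  ≡⟨ cong signR (proj₂ parity) ⟩
      signR (inversions (σ ⟨$⟩ʳ_) ℕ.+ 2 ℕ.* k)            ≈⟨ signR-+ (inversions (σ ⟨$⟩ʳ_)) (2 ℕ.* k) ⟩
      signR (inversions (σ ⟨$⟩ʳ_)) * signR (2 ℕ.* k)      ≈⟨ *-congˡ (signR-even k) ⟩
      signR (inversions (σ ⟨$⟩ʳ_)) * 1#                    ≈⟨ *-identityʳ _ ⟩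
      signR (inversions (σ ⟨$⟩ʳ_))                         ≡⟨ sgnPerm≡signR-inversions σ ⟨
      sgnPerm σ                                            ∎

  signR-invWord-++ : ∀ {n} (xs ys : List (Fin n)) →
    signR (invWord (xs ++ ys)) ≈ signR (invWord xs) * signR (invWord ys) * signR (crossInversions xs ys)
  signR-invWord-++ xs ys = begin
    signR (invWord (xs ++ ys))
      ≡⟨ cong signR (invWord-++ xs ys) ⟩
    signR (invWord xs ℕ.+ invWord ys ℕ.+ crossInversions xs ys)
      ≈⟨ signR-+ (invWord xs ℕ.+ invWord ys) (crossInversions xs ys) ⟩
    signR (invWord xs ℕ.+ invWord ys) * signR (crossInversions xs ys)
      ≈⟨ *-congʳ (signR-+ (invWord xs) (invWord ys)) ⟩
    signR (invWord xs) * signR (invWord ys) * signR (crossInversions xs ys) ∎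

  signR-rowWord-full : ∀ {n d} (σ : Permutation′ d) {row : Vec (Maybe (Fin n)) d} → InjectiveFullRow row →
    signR (invWord (rowWord row)) ≈ sgnPerm σ * signR (invWord (rowWord (permuteRow σ row)))
  signR-rowWord-full σ (f , refl , f-injective) = begin
    signR (invWord (rowWord (V.tabulate (just ∘ f))))
      ≡⟨ cong signR (invWord-rowWord-tabulate f) ⟩
    signR (inversions f)
      ≈⟨ signR-inversions-∘-permutation σ f f-injective ⟩
    sgnPerm σ * signR (inversions (f ∘ (σ ⟨$⟩ˡ_)))
      ≡⟨ cong (λ i → sgnPerm σ * signR i) permuted ⟨
    sgnPerm σ * signR (invWord (rowWord (permuteRow σ (V.tabulate (just ∘ f))))) ∎
    where
    permuted : invWord (rowWord (permuteRow σ (V.tabulate (just ∘ f)))) ≡ inversions (f ∘ (σ ⟨$⟩ˡ_))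
    permuted = trans (cong (invWord ∘ rowWord) (permuteRow-tabulate σ (just ∘ f)))
                     (invWord-rowWord-tabulate (f ∘ (σ ⟨$⟩ˡ_)))

  signR-rowWord-singleton : ∀ {n d} (σ : Permutation′ d) {row : Vec (Maybe (Fin n)) d} →
    countJust (toList row) ≡ 1 →
    signR (invWord (rowWord row)) ≈ 1# * signR (invWord (rowWord (permuteRow σ row)))
  signR-rowWord-singleton σ {row} singleton = begin
    signR (invWord (rowWord row))
      ≡⟨ cong signR (invWord-singleton (rowWord row) singleton) ⟩
    1#
      ≡⟨ cong signR (invWord-singleton (rowWord (permuteRow σ row)) singleton′) ⟨
    signR (invWord (rowWord (permuteRow σ row)))
      ≈⟨ *-identityˡ _ ⟨
    1# * signR (invWord (rowWord (permuteRow σ row))) ∎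
    where
    singleton′ : countJust (toList (permuteRow σ row)) ≡ 1
    singleton′ = trans (↭.↭-length (↭.catMaybes-↭ (toList-permuteRow σ row))) singleton

  signR-readingWord-∷ : ∀ {n d l} (σ : Permutation′ d) (row : Vec (Maybe (Fin n)) d) (T : Tableau n d l)
    {a b} →
    signR (invWord (rowWord row)) ≈ a * signR (invWord (rowWord (permuteRow σ row))) →
    signR (invWord (readingWord T)) ≈ b * signR (invWord (readingWord (permuteColumns σ T))) →
    signR (invWord (readingWord (row V.∷ T))) ≈
    (a * b) * signR (invWord (readingWord (permuteColumns σ (row V.∷ T))))
  signR-readingWord-∷ σ row T {a} {b} row≈ T≈ = begin
    signR (invWord (w ++ U))
      ≈⟨ signR-invWord-++ w U ⟩
    signR (invWord w) * signR (invWord U) * signR (crossInversions w U)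
      ≈⟨ *-cong (*-cong row≈ T≈) (reflexive (cong signR (crossInversions-↭ (↭-sym w′↭w) (↭-sym U′↭U)))) ⟩
    (a * signR (invWord w′)) * (b * signR (invWord U′)) * signR (crossInversions w′ U′)
      ≈⟨ solve 5 (λ a b x y z → ((a ⊕ x) ⊕ (b ⊕ y)) ⊕ z ⊜ (a ⊕ b) ⊕ ((x ⊕ y) ⊕ z)) ≈-refl
           a b (signR (invWord w′)) (signR (invWord U′)) (signR (crossInversions w′ U′)) ⟩
    (a * b) * (signR (invWord w′) * signR (invWord U′) * signR (crossInversions w′ U′))
      ≈⟨ *-congˡ (signR-invWord-++ w′ U′) ⟨
    (a * b) * signR (invWord (w′ ++ U′)) ∎
    where
    w = rowWord row
    w′ = rowWord (permuteRow σ row)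
    U = readingWord T
    U′ = readingWord (permuteColumns σ T)
    w′↭w : w′ ↭ w
    w′↭w = ↭.catMaybes-↭ (toList-permuteRow σ row)
    U′↭U : U′ ↭ U
    U′↭U = readingWord-permuteColumns σ T

  signR-readingWord-permuteColumns : ∀ {n d l} (σ : Permutation′ d) (T : Tableau n d l) t →
    (∀ k → toℕ k < t → InjectiveFullRow (lookup T k)) →
    (∀ k → ¬ toℕ k < t → countJust (toList (lookup T k)) ≡ 1) →
    signR (invWord (readingWord T)) ≈
    pow (sgnPerm σ) (t ⊓ l) * signR (invWord (readingWord (permuteColumns σ T)))
  signR-readingWord-permuteColumns σ V.[] zero full singleton = ≈-sym (*-identityˡ 1#)
  signR-readingWord-permuteColumns σ V.[] (suc t) full singleton = ≈-sym (*-identityˡ 1#)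
  signR-readingWord-permuteColumns σ (row V.∷ T) zero full singleton = ≈-trans
    (signR-readingWord-∷ σ row T (signR-rowWord-singleton σ {row} (singleton Fin.zero λ ()))
      (signR-readingWord-permuteColumns σ T zero (λ _ ()) (λ k _ → singleton (Fin.suc k) λ ())))
    (*-congʳ (*-identityˡ 1#))
  signR-readingWord-permuteColumns σ (row V.∷ T) (suc t) full singleton =
    signR-readingWord-∷ σ row T (signR-rowWord-full σ {row} (full Fin.zero (s≤s z≤n)))
      (signR-readingWord-permuteColumns σ T t (λ k k<t → full (Fin.suc k) (s≤s k<t))
        (λ k k≮t → singleton (Fin.suc k) (k≮t ∘ ℕ.≤-pred)))

  pow-sgnPerm-⊓ : ∀ {d} (σ : Permutation′ d) r m → (Fin d → r ≤ m) →
    pow (sgnPerm σ) (r ⊓ m) ≈ pow (sgnPerm σ) r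
  pow-sgnPerm-⊓ {zero} σ r m _ = ≈-trans (pow-1# (r ⊓ m)) (≈-sym (pow-1# r))
  pow-sgnPerm-⊓ {suc d} σ r m r≤m = reflexive (cong (pow (sgnPerm σ)) (ℕ.m≤n⇒m⊓n≡m (r≤m Fin.zero)))

  sum-cong : ∀ {A : Set} {f g : A → Carrier} → (∀ x → f x ≈ g x) → ∀ xs → sum (map f xs) ≈ sum (map g xs)
  sum-cong f≈g [] = ≈-refl
  sum-cong f≈g (x ∷ xs) = +-cong (f≈g x) (sum-cong f≈g xs)

  sum-map-*ˡ : ∀ {A : Set} k (g : A → Carrier) xs → sum (map (λ x → k * g x) xs) ≈ k * sum (map g xs)
  sum-map-*ˡ k g [] = ≈-sym (zeroʳ k)
  sum-map-*ˡ k g (x ∷ xs) = ≈-trans (+-congˡ (sum-map-*ˡ k g xs)) (≈-sym (distribˡ k (g x) _))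

  sum-filter : ∀ {A : Set} (p : A → Bool) (F : A → Carrier) xs →
    sum (map F (filter (λ x → p x Bool.≟ true) xs)) ≈ sum (map (λ x → if p x then F x else 0#) xs)
  sum-filter p F [] = ≈-refl
  sum-filter p F (x ∷ xs) with p x
  ... | true = +-congˡ (sum-filter p F xs)
  ... | false = ≈-trans (sum-filter p F xs) (≈-sym (+-identityˡ _))

  Jmon-permuteColumns : ∀ {n d} r M (σ : Permutation′ d) (π π′ : Fin n → Fin d) →
    (∀ x → π′ x ≡ σ ⟨$⟩ʳ π x) →
    ∀ T → Jmon r M π′ (permuteColumns σ T) ≈ Jmon r M π T
  Jmon-permuteColumns {n} {d} r M σ π π′ π′≡σπ T = begin
    prod (map (λ j → minorOf (rowSet (permuteColumns σ T) j) (block π′ j)) (L.allFin d))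
      ≡⟨ cong prod (L.map-cong (λ j → cong₂ minorOf (rowSet-permuteColumns σ T j) (block-relabel σ π π′ π′≡σπ j))
                               (L.allFin d)) ⟩
    prod (map (column-minor ∘ (σ ⟨$⟩ˡ_)) (L.allFin d))
      ≡⟨ cong prod (L.map-∘ (L.allFin d)) ⟩
    prod (map column-minor (map (σ ⟨$⟩ˡ_) (L.allFin d)))
      ≈⟨ prod-↭ (↭.map⁺ column-minor (map-permutation-allFin σ)) ⟩
    prod (map column-minor (L.allFin d)) ∎
    where
    minorOf : List (Fin (jrows n d r)) → List (Fin n) → Carrier
    minorOf rows cols = minor M (map (λ k → Fin.inject≤ k (ℕ.m∸n≤m n ((d ℕ.∸ 1) ℕ.* r))) rows) cols
    column-minor : Fin d → Carrier
    column-minor j = minorOf (rowSet T j) (block π j)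

  jellyfishTerm : ∀ {n d} r → (Fin n → Fin n → Carrier) → (Fin n → Fin d) →
    Tableau n d (jrows n d r) → Carrier
  jellyfishTerm r M π T = if isJellyfish r π T then signR (invWord (readingWord T)) * Jmon r M π T else 0#

  bracket≈sum-jellyfishTerm : ∀ {n d} r M (π : Fin n → Fin d) →
    bracket r M π ≈ sum (map (jellyfishTerm r M π) (allTableaux n d (jrows n d r)))
  bracket≈sum-jellyfishTerm {n} {d} r M π = sum-filter (isJellyfish r π)
    (λ T → signR (invWord (readingWord T)) * Jmon r M π T) (allTableaux n d (jrows n d r))

  jellyfishTerm-permuteColumns : ∀ {n d} r M (σ : Permutation′ d) (π π′ : Fin n → Fin d) →
    InOP n d r π → (∀ x → π′ x ≡ σ ⟨$⟩ʳ π x) →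
    ∀ T → jellyfishTerm r M π T ≈ pow (sgnPerm σ) r * jellyfishTerm r M π′ (permuteColumns σ T)
  jellyfishTerm-permuteColumns {n} {d} r M σ π π′ π∈OP π′≡σπ T
    rewrite isJellyfish-permuteColumns r σ π π′ π′≡σπ T with isJellyfish r π T in jelly
  ... | false = ≈-sym (zeroʳ _)
  ... | true = begin
    signR (invWord (readingWord T)) * Jmon r M π T
      ≈⟨ *-cong sign≈ (≈-sym (Jmon-permuteColumns r M σ π π′ π′≡σπ T)) ⟩
    (pow (sgnPerm σ) r * signR (invWord (readingWord (permuteColumns σ T)))) * Jmon r M π′ (permuteColumns σ T)
      ≈⟨ *-assoc _ _ _ ⟩
    pow (sgnPerm σ) r *
    (signR (invWord (readingWord (permuteColumns σ T))) * Jmon r M π′ (permuteColumns σ T)) ∎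
    where
    open JellyfishRows r π T jelly
    sign≈ : signR (invWord (readingWord T)) ≈
            pow (sgnPerm σ) r * signR (invWord (readingWord (permuteColumns σ T)))
    sign≈ = ≈-trans (signR-readingWord-permuteColumns σ T r full-rows singleton-rows)
                    (*-congʳ (pow-sgnPerm-⊓ σ r (jrows n d r) (λ j → r≤rows j π∈OP)))

corollary5p4 : ∀ {c ℓ} (R : CommutativeRing c ℓ) (n d r : ℕ)
    (M : Fin n → Fin n → CommutativeRing.Carrier R)
    (π π′ : Fin n → Fin d) → InOP n d r π → InOP n d r π′ →
    (σ : Permutation′ d) → (∀ x → π′ x ≡ σ ⟨$⟩ʳ π x) →
    CommutativeRing._≈_ R (WithRing.bracket R r M π)
      (CommutativeRing._*_ R (WithRing.pow R (WithRing.sgnPerm R σ) r) (WithRing.bracket R r M π′))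
corollary5p4 R n d r M π π′ π∈OP _ σ π′≡σπ = begin
  bracket r M π
    ≈⟨ bracket≈sum-jellyfishTerm R r M π ⟩
  sum (map (jellyfishTerm R r M π) tableaux)
    ≈⟨ sum-cong R (jellyfishTerm-permuteColumns R r M σ π π′ π∈OP π′≡σπ) tableaux ⟩
  sum (map (λ T → ε * jellyfishTerm R r M π′ (permuteColumns σ T)) tableaux)
    ≈⟨ sum-map-*ˡ R ε _ tableaux ⟩
  ε * sum (map (jellyfishTerm R r M π′ ∘ permuteColumns σ) tableaux)
    ≡⟨ cong (λ ts → ε * sum ts) (L.map-∘ tableaux) ⟩
  ε * sum (map (jellyfishTerm R r M π′) (map (permuteColumns σ) tableaux))
    ≈⟨ *-congˡ (sum-↭ R (↭.map⁺ _ (map-permuteColumns-allTableaux n (jrows n d r) σ))) ⟩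
  ε * sum (map (jellyfishTerm R r M π′) tableaux)
    ≈⟨ *-congˡ (bracket≈sum-jellyfishTerm R r M π′) ⟨
  ε * bracket r M π′ ∎
  where
  open CommutativeRing R using (_*_; *-congˡ; setoid)
  open WithRing R using (bracket; sum; pow; sgnPerm)
  open import Relation.Binary.Reasoning.Setoid setoid
  tableaux = allTableaux n d (jrows n d r)
  ε = pow (sgnPerm σ) r
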